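{- Let $G$ be a connected $P_5$-free graph. If $G$ admits a perfect edge dominating set other than $E(G)$, then $G$ has a dominating induced $P_3$ or a dominating $K_3$.
   Context: Graphs are finite, simple and undirected; $P_k$ is the path on $k$ vertices and a graph is $P_5$-free if it has no induced $P_5$. An edge dominates itself and every edge sharing an endpoint with it. A set $P\subseteq E(G)$ is a perfect edge dominating set if every edge of $E(G)\setminus P$ is dominated by exactly one edge of $P$. A set $X$ of vertices is dominating if every vertex outside $X$ has a neighbour in $X$; a dominating induced $P_3$ (resp. dominating $K_3$) is a dominating set inducing $P_3$ (resp. $K_3$). -}

module Defs where

open import Data.Nat using (ℕ)
open import Data.Fin using (Fin)
open import Data.Product using (Σ; _×_; ∃-syntax)
open import Data.Sum using (_⊎_)
open import Relation.Nullary using (¬_; Dec)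
open import Relation.Binary.PropositionalEquality using (_≡_)

record Graph : Set₁ where
  field
    n      : ℕ
    Adj    : Fin n → Fin n → Set
    sym    : ∀ {u v} → Adj u v → Adj v u
    irrefl : ∀ {u} → ¬ Adj u u
    dec    : ∀ u v → Dec (Adj u v)
open Graph public

module _ (G : Graph) where
  V : Set
  V = Fin (n G)

  data Reach : V → V → Set where
    here : ∀ {u} → Reach u u
    step : ∀ {u w v} → Adj G u w → Reach w v → Reach u v

  Connected : Set
  Connected = ∀ u v → Reach u v

  InducedP5 : V → V → V → V → V → Set
  InducedP5 a b c d e =
    ¬ a ≡ b × ¬ a ≡ c × ¬ a ≡ d × ¬ a ≡ e × ¬ b ≡ c × ¬ b ≡ d × ¬ b ≡ e ×
    ¬ c ≡ d × ¬ c ≡ e × ¬ d ≡ e ×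
    Adj G a b × Adj G b c × Adj G c d × Adj G d e ×
    ¬ Adj G a c × ¬ Adj G a d × ¬ Adj G a e ×
    ¬ Adj G b d × ¬ Adj G b e × ¬ Adj G c e

  P5Free : Set
  P5Free = ∀ a b c d e → ¬ InducedP5 a b c d e

  -- an edge {u,v} is represented by an ordered pair with Adj u v;
  -- two representatives denote the same edge iff they agree as unordered pairs
  SameEdge : V → V → V → V → Set
  SameEdge a b c d = (a ≡ c × b ≡ d) ⊎ (a ≡ d × b ≡ c)

  EdgeDominates : V → V → V → V → Set
  EdgeDominates a b c d = a ≡ c ⊎ a ≡ d ⊎ b ≡ c ⊎ b ≡ d

  record EdgeSet : Set₁ where
    field
      Mem    : V → V → Set
      sub    : ∀ {u v} → Mem u v → Adj G u v
      memSym : ∀ {u v} → Mem u v → Mem v u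
  open EdgeSet public

  PerfectEdgeDominating : EdgeSet → Set
  PerfectEdgeDominating P =
    ∀ u v → Adj G u v → ¬ Mem P u v →
      (∃[ a ] ∃[ b ] (Mem P a b × EdgeDominates a b u v)) ×
      (∀ a b c d → Mem P a b → EdgeDominates a b u v →
                   Mem P c d → EdgeDominates c d u v → SameEdge a b c d)

  NotAllEdges : EdgeSet → Set
  NotAllEdges P = ∃[ u ] ∃[ v ] (Adj G u v × ¬ Mem P u v)

  Dominating : (V → Set) → Set
  Dominating X = ∀ v → ¬ X v → ∃[ w ] (X w × Adj G v w)

  Triple : V → V → V → V → Set
  Triple a b c v = v ≡ a ⊎ v ≡ b ⊎ v ≡ c

  DominatingInducedP3 : Set
  DominatingInducedP3 = ∃[ a ] ∃[ b ] ∃[ c ]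
    (¬ a ≡ c × Adj G a b × Adj G b c × ¬ Adj G a c × Dominating (Triple a b c))

  DominatingK3 : Set
  DominatingK3 = ∃[ a ] ∃[ b ] ∃[ c ]
    (Adj G a b × Adj G b c × Adj G a c × Dominating (Triple a b c))

-- Call (x, t, s) a hook if x lies on no edge of P, x ~ t and ts ∈ P. An edge outside P
-- yields a hook: its endpoint not covered by the dominating P-edge lies on no edge of P.
-- If the closed neighbourhood N[x, t, s] of a hook misses a vertex, connectivity gives a
-- vertex y outside it adjacent to some z inside. Since adjacent covered vertices are
-- joined by a P-edge and neighbours of uncovered vertices have a unique P-neighbour, a
-- case analysis on z, in which every obstruction closes an induced P5, yields a hook whose
-- neighbourhood contains N[x, t, s] and y. So a hook with maximal neighbourhood dominates
-- G, and {x, t, s} induces K3 or P3 according to whether x ~ s.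
module Submission where

open import Defs
open import Data.Empty using (⊥; ⊥-elim)
open import Data.Fin using (Fin; _≟_)
open import Data.Fin.Properties using (any?; all?; ¬∀⟶∃¬)
open import Data.Fin.Subset using (Subset; _∈_; _⊂_; _⊃_)
open import Data.Fin.Subset.Induction using (⊃-wellFounded)
open import Data.Product using (Σ; _×_; _,_; proj₁; proj₂; ∃; ∃-syntax)
open import Data.Sum using (_⊎_; inj₁; inj₂)
open import Data.Vec using (tabulate)
open import Data.Vec.Properties using (lookup∘tabulate; lookup⇒[]=; []=⇒lookup)
open import Function using (_∘_)
open import Induction.WellFounded using (Acc; acc)
open import Relation.Nullary using (¬_; Dec; yes; no; does)
open import Relation.Nullary.Decidable
  using (_×-dec_; _⊎-dec_; _→-dec_; ¬?; dec-true; decidable-stable)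
open import Relation.Unary using (Pred; Decidable; _⊆_; _∪_)
open import Relation.Unary.Properties using (_∪?_)
open import Relation.Binary.PropositionalEquality
  using (_≡_; _≢_; refl; trans; subst) renaming (sym to ≡-sym)

toSubset : ∀ {m p} {P : Pred (Fin m) p} → Decidable P → Subset m
toSubset P? = tabulate (does ∘ P?)

module _ {m p} {P : Pred (Fin m) p} (P? : Decidable P) where

  ∈-toSubset⁺ : ∀ {v} → P v → v ∈ toSubset P?
  ∈-toSubset⁺ {v} pv =
    lookup⇒[]= v (toSubset P?) (trans (lookup∘tabulate (does ∘ P?) v) (dec-true (P? v) pv))

  ∈-toSubset⁻ : ∀ {v} → v ∈ toSubset P? → P v
  ∈-toSubset⁻ {v} v∈ with P? v | trans (≡-sym (lookup∘tabulate (does ∘ P?) v)) ([]=⇒lookup v∈)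
  ... | yes pv | _ = pv
  ... | no _ | ()

toSubset-⊂ : ∀ {m p q} {P : Pred (Fin m) p} {Q : Pred (Fin m) q} (P? : Decidable P) (Q? : Decidable Q) →
  P ⊆ Q → ∀ {y} → Q y → ¬ P y → toSubset P? ⊂ toSubset Q?
toSubset-⊂ P? Q? P⊆Q {y} qy ¬py =
  (λ v∈ → ∈-toSubset⁺ Q? (P⊆Q (∈-toSubset⁻ P? v∈))) , y , ∈-toSubset⁺ Q? qy , ¬py ∘ ∈-toSubset⁻ P?

⊂-ascent-reaches : ∀ {c r m} {C : Set c} (S : C → Subset m) (R : Pred C r) →
  (∀ a → ¬ R a → ¬ ¬ (∃[ b ] S a ⊂ S b)) → C → ¬ ¬ ∃ R
⊂-ascent-reaches S R ascend a₀ = go a₀ (⊃-wellFounded (S a₀))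
  where
  go : ∀ a → Acc _⊃_ (S a) → ¬ ¬ ∃ R
  go a (acc larger) ¬∃R =
    ascend a (λ ra → ¬∃R (a , ra)) λ { (b , a⊂b) → go b (larger a⊂b) ¬∃R }

pattern self₁ = inj₁ (inj₁ refl)
pattern adj₁ p = inj₁ (inj₂ p)
pattern self₂ = inj₂ (inj₁ (inj₁ refl))
pattern adj₂ p = inj₂ (inj₁ (inj₂ p))
pattern self₃ = inj₂ (inj₂ (inj₁ refl))
pattern adj₃ p = inj₂ (inj₂ (inj₂ p))

module Neighbourhoods (G : Graph) where

  infix 4 _~_ _≁_

  _~_ : V G → V G → Set
  _~_ = Adj G

  _≁_ : V G → V G → Set
  u ≁ v = ¬ u ~ v

  ~-sym : ∀ {u v} → u ~ v → v ~ u
  ~-sym = sym G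

  Closed : V G → Pred (V G) _
  Closed u v = v ≡ u ⊎ v ~ u

  Near : V G → V G → V G → Pred (V G) _
  Near x t s = Closed x ∪ Closed t ∪ Closed s

  Near? : ∀ x t s → Decidable (Near x t s)
  Near? x t s = closed? x ∪? closed? t ∪? closed? s
    where
    closed? : ∀ u → Decidable (Closed u)
    closed? u v = (v ≟ u) ⊎-dec dec G v u

  near-swap : ∀ {x t s} → Near x t s ⊆ Near x s t
  near-swap self₁ = self₁
  near-swap (adj₁ p) = adj₁ p
  near-swap self₂ = self₃
  near-swap (adj₂ p) = adj₃ p
  near-swap self₃ = self₂
  near-swap (adj₃ p) = adj₂ p

  near-everywhere⇒dominating : ∀ {x t s} → (∀ v → Near x t s v) → Dominating G (Triple G x t s)
  near-everywhere⇒dominating {x} {t} {s} near v v∉ with near v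
  ... | self₁ = ⊥-elim (v∉ (inj₁ refl))
  ... | self₂ = ⊥-elim (v∉ (inj₂ (inj₁ refl)))
  ... | self₃ = ⊥-elim (v∉ (inj₂ (inj₂ refl)))
  ... | adj₁ v~x = x , inj₁ refl , v~x
  ... | adj₂ v~t = t , inj₂ (inj₁ refl) , v~t
  ... | adj₃ v~s = s , inj₂ (inj₂ refl) , v~s

  boundary-edge : ∀ {q} (Q : Pred (V G) q) → Decidable Q → ∀ {u v} → Reach G u v → Q u → ¬ Q v →
    ∃[ z ] ∃[ w ] (Q z × ¬ Q w × z ~ w)
  boundary-edge Q Q? here qu ¬qv = ⊥-elim (¬qv qu)
  boundary-edge Q Q? {u} (step {w = w} u~w w⇝v) qu ¬qv with Q? w
  ... | yes qw = boundary-edge Q Q? w⇝v qw ¬qv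
  ... | no ¬qw = u , w , qu , ¬qw , u~w

  no-induced-P5 : P5Free G → ∀ {a b c d e} → a ~ b → b ~ c → c ~ d → d ~ e →
    a ≁ c → a ≁ d → a ≁ e → b ≁ d → b ≁ e → c ≁ e → ⊥
  no-induced-P5 p5 a~b b~c c~d d~e a≁c a≁d a≁e b≁d b≁e c≁e =
    p5 _ _ _ _ _
      ( (λ { refl → irrefl G a~b }) , (λ { refl → a≁d c~d }) , (λ { refl → a≁c (~-sym c~d) })
      , (λ { refl → a≁d (~-sym d~e) }) , (λ { refl → irrefl G b~c }) , (λ { refl → a≁d a~b })
      , (λ { refl → a≁e a~b }) , (λ { refl → irrefl G c~d }) , (λ { refl → b≁e b~c })
      , (λ { refl → irrefl G d~e })
      , a~b , b~c , c~d , d~e , a≁c , a≁d , a≁e , b≁d , b≁e , c≁e )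

  dominating-P3-or-K3? : Dec (DominatingInducedP3 G ⊎ DominatingK3 G)
  dominating-P3-or-K3? = P3? ⊎-dec K3?
    where
    triple? : ∀ a b c → Decidable (Triple G a b c)
    triple? a b c v = (v ≟ a) ⊎-dec (v ≟ b) ⊎-dec (v ≟ c)
    dominating? : ∀ a b c → Dec (Dominating G (Triple G a b c))
    dominating? a b c = all? λ v → ¬? (triple? a b c v) →-dec any? λ w → triple? a b c w ×-dec dec G v w
    P3? : Dec (DominatingInducedP3 G)
    P3? = any? λ a → any? λ b → any? λ c →
      ¬? (a ≟ c) ×-dec dec G a b ×-dec dec G b c ×-dec ¬? (dec G a c) ×-dec dominating? a b c
    K3? : Dec (DominatingK3 G)
    K3? = any? λ a → any? λ b → any? λ c →
      dec G a b ×-dec dec G b c ×-dec dec G a c ×-dec dominating? a b c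

module PerfectEdgeDomination (G : Graph) (P : EdgeSet G) (ped : PerfectEdgeDominating G P) where
  open Neighbourhoods G

  infix 4 _─_

  _─_ : V G → V G → Set
  _─_ = Mem P

  ─-sym : ∀ {u v} → u ─ v → v ─ u
  ─-sym = memSym P

  ─⇒~ : ∀ {u v} → u ─ v → u ~ v
  ─⇒~ = sub P

  Uncovered : Pred (V G) _
  Uncovered v = ∀ w → ¬ v ─ w

  AtMostOneMate : Pred (V G) _
  AtMostOneMate v = ∀ {a b} → v ─ a → v ─ b → a ≡ b

  private variable a b i m u v w : V G

  uncovered-independent : Uncovered u → Uncovered v → u ≁ v
  uncovered-independent {u} {v} u-unc v-unc u~v with proj₁ (ped u v u~v (u-unc v))
  ... | _ , b , a─b , inj₁ refl = u-unc b a─b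
  ... | _ , b , a─b , inj₂ (inj₁ refl) = v-unc b a─b
  ... | a , _ , a─b , inj₂ (inj₂ (inj₁ refl)) = u-unc a (─-sym a─b)
  ... | a , _ , a─b , inj₂ (inj₂ (inj₂ refl)) = v-unc a (─-sym a─b)

  uncovered-nbr-covered : Uncovered i → i ~ w → ∃[ a ] w ─ a
  uncovered-nbr-covered {i} {w} i-unc i~w with proj₁ (ped i w i~w (i-unc w))
  ... | _ , b , a─b , inj₁ refl = ⊥-elim (i-unc b a─b)
  ... | _ , b , a─b , inj₂ (inj₁ refl) = b , a─b
  ... | a , _ , a─b , inj₂ (inj₂ (inj₁ refl)) = ⊥-elim (i-unc a (─-sym a─b))
  ... | a , _ , a─b , inj₂ (inj₂ (inj₂ refl)) = a , ─-sym a─b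

  -- Two P-edges at u would both dominate the non-P edge uv.
  non-P-edge⇒AtMostOneMate : u ~ v → ¬ u ─ v → AtMostOneMate u
  non-P-edge⇒AtMostOneMate {u} {v} u~v u-/-v u─a u─b
    with proj₂ (ped u v u~v u-/-v) _ _ _ _ u─a (inj₁ refl) u─b (inj₁ refl)
  ... | inj₁ (_ , a≡b) = a≡b
  ... | inj₂ (_ , refl) = ⊥-elim (irrefl G (─⇒~ u─a))

  uncovered-nbr-AtMostOneMate : Uncovered i → i ~ w → AtMostOneMate w
  uncovered-nbr-AtMostOneMate i-unc i~w = non-P-edge⇒AtMostOneMate (~-sym i~w) (i-unc _ ∘ ─-sym)

  covered-edge-in-P : u ~ v → u ─ a → v ─ b → ¬ ¬ u ─ v
  covered-edge-in-P {u} {v} u~v u─a v─b u-/-v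
    with proj₂ (ped u v u~v u-/-v) _ _ _ _ u─a (inj₁ refl) v─b (inj₂ (inj₁ refl))
  ... | inj₁ (refl , _) = irrefl G u~v
  ... | inj₂ (_ , refl) = u-/-v u─a

  covered-nbr-is-mate : AtMostOneMate u → u ─ m → u ~ v → v ─ b → v ≡ m
  covered-nbr-is-mate {u} {m} {v} u-mate u─m u~v v─b = decidable-stable (v ≟ m) λ v≢m →
    covered-edge-in-P u~v u─m v─b λ u─v → v≢m (u-mate u─v u─m)

  non-mate-nbr-uncovered : AtMostOneMate u → u ─ m → u ~ v → v ≢ m → Uncovered v
  non-mate-nbr-uncovered u-mate u─m u~v v≢m _ v─b = v≢m (covered-nbr-is-mate u-mate u─m u~v v─b)

  non-P-edge-at-covered⇒uncovered : u ~ v → ¬ u ─ v → u ─ b → Uncovered v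
  non-P-edge-at-covered⇒uncovered {u} {v} u~v u-/-v u─b c v─c
    with proj₂ (ped u v u~v u-/-v) _ _ _ _ u─b (inj₁ refl) v─c (inj₂ (inj₁ refl))
  ... | inj₁ (refl , _) = irrefl G u~v
  ... | inj₂ (_ , refl) = u-/-v u─b

module Hooks (G : Graph) (P : EdgeSet G) (ped : PerfectEdgeDominating G P) (p5 : P5Free G) where
  open Neighbourhoods G
  open PerfectEdgeDomination G P ped

  record Hook : Set where
    constructor hook
    field
      x t s       : V G
      x-uncovered : Uncovered x
      x~t         : x ~ t
      t─s         : t ─ s

  N[_] : Hook → Pred (V G) _
  N[ h ] = Near x t s where open Hook h

  N?[_] : ∀ h → Decidable N[ h ]
  N?[ h ] = Near? x t s where open Hook h

  Grows : Hook → V G → Set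
  Grows h y = ∃[ h′ ] (N[ h ] ⊆ N[ h′ ] × N[ h′ ] y)

  Full : Pred Hook _
  Full h = ∀ v → N[ h ] v

  non-P-edge⇒hook : NotAllEdges G P → Hook
  non-P-edge⇒hook (u , v , u~v , u-/-v) with proj₁ (ped u v u~v u-/-v)
  ... | _ , b , u─b , inj₁ refl =
    hook v u b (non-P-edge-at-covered⇒uncovered u~v u-/-v u─b) (~-sym u~v) u─b
  ... | _ , b , v─b , inj₂ (inj₁ refl) =
    hook u v b (non-P-edge-at-covered⇒uncovered (~-sym u~v) (u-/-v ∘ ─-sym) v─b) u~v v─b
  ... | a , _ , a─u , inj₂ (inj₂ (inj₁ refl)) =
    hook v u a (non-P-edge-at-covered⇒uncovered u~v u-/-v (─-sym a─u)) (~-sym u~v) (─-sym a─u)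
  ... | a , _ , a─v , inj₂ (inj₂ (inj₂ refl)) =
    hook u v a (non-P-edge-at-covered⇒uncovered (~-sym u~v) (u-/-v ∘ ─-sym) (─-sym a─v)) u~v (─-sym a─v)

  dominating-hook : ∀ h → Full h → DominatingInducedP3 G ⊎ DominatingK3 G
  dominating-hook (hook x t s x-unc x~t t─s) near with dec G x s
  ... | yes x~s = inj₂ (x , t , s , x~t , ─⇒~ t─s , x~s , near-everywhere⇒dominating near)
  ... | no x≁s = inj₁ (x , t , s , (λ { refl → x-unc t (─-sym t─s) }) , x~t , ─⇒~ t─s , x≁s ,
                        near-everywhere⇒dominating near)

  module Growth (h : Hook) {y} (y∉N : ¬ N[ h ] y) where
    open Hook h renaming (x-uncovered to x-unc)

    y≁x : y ≁ x
    y≁x y~x = y∉N (adj₁ y~x)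

    y≁t : y ≁ t
    y≁t y~t = y∉N (adj₂ y~t)

    y≁s : y ≁ s
    y≁s y~s = y∉N (adj₃ y~s)

    x≁y : x ≁ y
    x≁y = y≁x ∘ ~-sym

    t≁y : t ≁ y
    t≁y = y≁t ∘ ~-sym

    s≁y : s ≁ y
    s≁y = y≁s ∘ ~-sym

    t-mate : AtMostOneMate t
    t-mate = uncovered-nbr-AtMostOneMate x-unc x~t

    y≁covered-nbr-of-t : ∀ {w b} → t ~ w → w ─ b → y ≁ w
    y≁covered-nbr-of-t t~w w─b y~w = y≁s (subst (y ~_) (covered-nbr-is-mate t-mate t─s t~w w─b) y~w)

    -- A neighbour v ≠ u′ of u outside N[x, w, c] is uncovered, so v - u - x - w - y
    -- would be an induced P5.
    P5-forces-near : ∀ {w c u u′ v} → x ~ w → w ~ y →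
      (∀ {v} → Uncovered v → ¬ Near x w c v → v ≁ y) →
      x ~ u → u ─ u′ → Near x w c u′ → u ≁ w → u ≁ y → v ~ u → Near x w c v
    P5-forces-near {w} {c} {v = v} x~w w~y v≁y x~u u─u′ u′-near u≁w u≁y v~u =
      decidable-stable (Near? x w c v) λ v-far →
        let v-unc = non-mate-nbr-uncovered (uncovered-nbr-AtMostOneMate x-unc x~u) u─u′ (~-sym v~u)
                      λ { refl → v-far u′-near }
        in no-induced-P5 p5 v~u (~-sym x~u) x~w w~y
             (uncovered-independent v-unc x-unc) (λ v~w → v-far (adj₂ v~w)) (v≁y v-unc v-far)
             u≁w u≁y x≁y

    via-mate-adjacent-to-x : ∀ {y′} → y ─ y′ → y′ ~ x → Grows h y
    via-mate-adjacent-to-x {y′} y─y′ y′~x =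
      hook x y′ y x-unc x~y′ (─-sym y─y′) , N⊆ , self₃
      where
      x~y′ : x ~ y′
      x~y′ = ~-sym y′~x
      y′~y : y′ ~ y
      y′~y = ~-sym (─⇒~ y─y′)
      t≁y′ : t ≁ y′
      t≁y′ t~y′ = y≁covered-nbr-of-t t~y′ (─-sym y─y′) (~-sym y′~y)
      s≁y′ : s ≁ y′
      s≁y′ s~y′ = y∉N (subst N[ h ]
        (covered-nbr-is-mate (uncovered-nbr-AtMostOneMate x-unc x~y′) (─-sym y─y′) (~-sym s~y′) (─-sym t─s))
        self₃)
      x~s : x ~ s
      x~s = decidable-stable (dec G x s) λ x≁s →
        no-induced-P5 p5 (~-sym (─⇒~ t─s)) (~-sym x~t) x~y′ y′~y
          (λ s~x → x≁s (~-sym s~x)) s≁y′ s≁y t≁y′ t≁y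
          x≁y
      v≁y : ∀ {v} → Uncovered v → ¬ Near x y′ y v → v ≁ y
      v≁y _ v-far v~y = v-far (adj₃ v~y)
      N⊆ : N[ h ] ⊆ Near x y′ y
      N⊆ self₁ = self₁
      N⊆ self₂ = adj₁ (~-sym x~t)
      N⊆ self₃ = adj₁ (~-sym x~s)
      N⊆ (adj₁ v~x) = adj₁ v~x
      N⊆ (adj₂ v~t) =
        P5-forces-near x~y′ y′~y v≁y x~t t─s (adj₁ (~-sym x~s)) t≁y′ t≁y v~t
      N⊆ (adj₃ v~s) =
        P5-forces-near x~y′ y′~y v≁y x~s (─-sym t─s) (adj₁ (~-sym x~t)) s≁y′ s≁y v~s

    via-uncovered-mate-far-from-x : ∀ {z y′} → Uncovered z → t ~ z → z ~ y → y ─ y′ → y′ ≁ x → Grows h y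
    via-uncovered-mate-far-from-x {z} {y′} z-unc t~z z~y y─y′ y′≁x =
      hook z t s z-unc (~-sym t~z) t─s , N⊆ , adj₁ (~-sym z~y)
      where
      N⊆ : N[ h ] ⊆ Near z t s
      N⊆ self₁ = adj₂ x~t
      N⊆ self₂ = self₂
      N⊆ self₃ = self₃
      N⊆ (adj₂ v~t) = adj₂ v~t
      N⊆ (adj₃ v~s) = adj₃ v~s
      N⊆ {v} (adj₁ v~x) = decidable-stable (Near? z t s v) λ v-far →
        no-induced-P5 p5 v~x x~t t~z z~y
          (λ v~t → v-far (adj₂ v~t)) (λ v~z → v-far (adj₁ v~z))
          (λ v~y → let v─a = proj₂ (uncovered-nbr-covered x-unc (~-sym v~x))
                       v≡y′ = covered-nbr-is-mate (uncovered-nbr-AtMostOneMate z-unc z~y) y─y′ (~-sym v~y) v─a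
                   in y′≁x (subst (_~ x) v≡y′ v~x))
          (uncovered-independent x-unc z-unc) x≁y t≁y

    via-uncovered-nbr-of-t : ∀ {z} → Uncovered z → t ~ z → z ~ y → Grows h y
    via-uncovered-nbr-of-t z-unc t~z z~y with uncovered-nbr-covered z-unc z~y
    ... | y′ , y─y′ with dec G y′ x
    ...   | yes y′~x = via-mate-adjacent-to-x y─y′ y′~x
    ...   | no y′≁x = via-uncovered-mate-far-from-x z-unc t~z z~y y─y′ y′≁x

    via-covered-nbr-of-x : ∀ {z a} → z ─ a → z ~ x → z ~ y → Grows h y
    via-covered-nbr-of-x {z} {a} z─a z~x z~y = hook x z a x-unc x~z z─a , N⊆ , adj₂ (~-sym z~y)
      where
      x~z : x ~ z
      x~z = ~-sym z~x
      z-mate : AtMostOneMate z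
      z-mate = uncovered-nbr-AtMostOneMate x-unc x~z
      t≁z : t ≁ z
      t≁z t~z = y≁covered-nbr-of-t t~z z─a (~-sym z~y)
      v≁y : ∀ {v} → Uncovered v → ¬ Near x z a v → v ≁ y
      v≁y v-unc v-far v~y = uncovered-independent v-unc
        (λ b y─b → v-far (adj₃ (subst (_ ~_) (covered-nbr-is-mate z-mate z─a z~y y─b) v~y))) v~y
      s-near-or-adjacent-to-x : s ≡ a ⊎ (x ~ s × s ≁ z)
      s-near-or-adjacent-to-x with dec G z s
      ... | yes z~s = inj₁ (covered-nbr-is-mate z-mate z─a z~s (─-sym t─s))
      ... | no z≁s = inj₂ (x~s , λ s~z → z≁s (~-sym s~z))
        where
        x~s : x ~ s
        x~s = decidable-stable (dec G x s) λ x≁s →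
          no-induced-P5 p5 (~-sym z~y) z~x x~t (─⇒~ t─s) y≁x y≁t y≁s (λ z~t → t≁z (~-sym z~t)) z≁s x≁s
      s-near : Near x z a s
      s-near with s-near-or-adjacent-to-x
      ... | inj₁ s≡a = subst (Near x z a) (≡-sym s≡a) self₃
      ... | inj₂ (x~s , _) = adj₁ (~-sym x~s)
      N⊆ : N[ h ] ⊆ Near x z a
      N⊆ self₁ = self₁
      N⊆ self₂ = adj₁ (~-sym x~t)
      N⊆ self₃ = s-near
      N⊆ (adj₁ v~x) = adj₁ v~x
      N⊆ (adj₂ v~t) = P5-forces-near x~z z~y v≁y x~t t─s s-near t≁z t≁y v~t
      N⊆ (adj₃ v~s) with s-near-or-adjacent-to-x
      ... | inj₁ s≡a = adj₃ (subst (_ ~_) s≡a v~s)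
      ... | inj₂ (x~s , s≁z) =
        P5-forces-near x~z z~y v≁y x~s (─-sym t─s) (adj₁ (~-sym x~t)) s≁z s≁y v~s

    covered-nbr-of-s-adjacent-to-x : ∀ {z a} → z ─ a → z ~ s → z ~ y → z ~ x
    covered-nbr-of-s-adjacent-to-x {z} z─a z~s z~y = decidable-stable (dec G z x) λ z≁x →
      covered-edge-in-P z~s z─a (─-sym t─s) λ z─s →
        let s≁x : s ≁ x
            s≁x s~x = y≁t (subst (y ~_)
              (≡-sym (uncovered-nbr-AtMostOneMate x-unc (~-sym s~x) (─-sym t─s) (─-sym z─s))) (~-sym z~y))
        in no-induced-P5 p5 (~-sym z~y) z~s (─⇒~ (─-sym t─s)) (~-sym x~t) y≁s y≁t y≁x
             (λ z~t → y≁covered-nbr-of-t (~-sym z~t) z─a (~-sym z~y)) z≁x s≁x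

    near-nbr-of-y : ∀ {z} → N[ h ] z → z ~ y → z ~ x ⊎ z ~ t ⊎ z ~ s
    near-nbr-of-y self₁ z~y = ⊥-elim (y≁x (~-sym z~y))
    near-nbr-of-y self₂ z~y = ⊥-elim (y≁t (~-sym z~y))
    near-nbr-of-y self₃ z~y = ⊥-elim (y≁s (~-sym z~y))
    near-nbr-of-y (adj₁ z~x) _ = inj₁ z~x
    near-nbr-of-y (adj₂ z~t) _ = inj₂ (inj₁ z~t)
    near-nbr-of-y (adj₃ z~s) _ = inj₂ (inj₂ z~s)

    via-covered : ∀ {z a} → z ─ a → N[ h ] z → z ~ y → Grows h y
    via-covered z─a z-near z~y with near-nbr-of-y z-near z~y
    ... | inj₁ z~x = via-covered-nbr-of-x z─a z~x z~y
    ... | inj₂ (inj₁ z~t) = ⊥-elim (y≁covered-nbr-of-t (~-sym z~t) z─a (~-sym z~y))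
    ... | inj₂ (inj₂ z~s) = via-covered-nbr-of-x z─a (covered-nbr-of-s-adjacent-to-x z─a z~s z~y) z~y

  module Enlargement (h : Hook) {y} (y∉N : ¬ N[ h ] y) where
    open Hook h renaming (x-uncovered to x-unc)
    open Growth h y∉N

    via-uncovered : ∀ {z} → Uncovered z → N[ h ] z → z ~ y → Grows h y
    via-uncovered {z} z-unc z-near z~y with near-nbr-of-y z-near z~y
    ... | inj₁ z~x = ⊥-elim (uncovered-independent z-unc x-unc z~x)
    ... | inj₂ (inj₁ z~t) = via-uncovered-nbr-of-t z-unc (~-sym z~t) z~y
    ... | inj₂ (inj₂ z~s) with dec G z t
    ...   | yes z~t = via-uncovered-nbr-of-t z-unc (~-sym z~t) z~y
    ...   | no z≁t with Growth.via-uncovered-nbr-of-t (hook x s t x-unc x~s (─-sym t─s)) (y∉N ∘ near-swap)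
                          z-unc (~-sym z~s) z~y
      where
      x~s : x ~ s
      x~s = decidable-stable (dec G x s) λ x≁s →
        no-induced-P5 p5 (~-sym z~y) z~s (─⇒~ (─-sym t─s)) (~-sym x~t) y≁s y≁t y≁x z≁t
          (uncovered-independent z-unc x-unc) (λ s~x → x≁s (~-sym s~x))
    ...     | h′ , N⊆ , y-near = h′ , N⊆ ∘ near-swap , y-near

    -- Being covered is not decidable, so the case split on z happens under a double negation.
    grow : ∀ {z} → N[ h ] z → z ~ y → ¬ ¬ Grows h y
    grow z-near z~y ¬grows =
      ¬grows (via-uncovered (λ _ z─a → ¬grows (via-covered z─a z-near z~y)) z-near z~y)

  hook-enlargeable : Connected G → ∀ h → ¬ Full h → ¬ ¬ (∃[ h′ ] toSubset N?[ h ] ⊂ toSubset N?[ h′ ])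
  hook-enlargeable conn h ¬full ¬enlargeable
    with ¬∀⟶∃¬ _ N[ h ] N?[ h ] ¬full
  ... | far , far∉N with boundary-edge N[ h ] N?[ h ] (conn (Hook.x h) far) self₁ far∉N
  ... | z , y , z-near , y∉N , z~y = Enlargement.grow h y∉N z-near z~y λ { (h′ , N⊆ , y-near) →
        ¬enlargeable (h′ , toSubset-⊂ N?[ h ] N?[ h′ ] N⊆ y-near y∉N) }

corollary21 : (G : Graph) → Connected G → P5Free G →
    Σ (EdgeSet G) (λ P → PerfectEdgeDominating G P × NotAllEdges G P) →
    DominatingInducedP3 G ⊎ DominatingK3 G
corollary21 G conn p5 (P , ped , P≠E) = decidable-stable dominating-P3-or-K3? λ ¬dominated →
  ⊂-ascent-reaches (λ h → toSubset N?[ h ]) Full (hook-enlargeable conn) (non-P-edge⇒hook P≠E)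
    λ { (h , full) → ¬dominated (dominating-hook h full) }
  where
  open Neighbourhoods G
  open Hooks G P ped p5
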